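{- For every purely modal formula $A$ (no $\blacksquare$, no $\lozenge^{\bullet}$), $A$ is derivable in $\mathbf{DKS4}$ iff $A$ is a theorem of S4.
   Context: Formulae are in negation normal form over $a,\neg a,\lor,\land,\square,\blacksquare,\lozenge,\lozenge^{\bullet}$, where $\lozenge^{\bullet}$ is the past diamond (dual of $\blacksquare$). Nested sequents are multisets of formulae and structures $\circ\{\Gamma\}$, $\bullet\{\Delta\}$; $\Sigma[\,]$ is a context with a hole at any depth. $\mathbf{DKS4}$ consists of the rules: $id$: $\Sigma[a,\overline a]$; $\land$: from $\Sigma[A\land B,A]$ and $\Sigma[A\land B,B]$ infer $\Sigma[A\land B]$; $\lor$: from $\Sigma[A\lor B,A,B]$ infer $\Sigma[A\lor B]$; $\square$: from $\Sigma[\square A,\circ\{A\}]$ infer $\Sigma[\square A]$; $\lozenge_1$: from $\Sigma[\circ\{\Delta,A\},\lozenge A]$ infer $\Sigma[\circ\{\Delta\},\lozenge A]$; $T_b$: from $\Sigma[\lozenge A,A]$ infer $\Sigma[\lozenge A]$; $4_c$: from $\Sigma[\lozenge A,\circ\{\lozenge A,\Delta\}]$ infer $\Sigma[\lozenge A,\circ\{\Delta\}]$. -}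

module Defs where

open import Data.Nat using (ℕ)
open import Data.List using (List; []; _∷_; _++_; [_])

-- Formulae in negation normal form (atoms are natural numbers)

data Fml : Set where
  atom  : ℕ → Fml
  neg   : ℕ → Fml
  _∨'_  : Fml → Fml → Fml
  _∧'_  : Fml → Fml → Fml
  □     : Fml → Fml          -- future box
  ■     : Fml → Fml          -- past box
  ◇     : Fml → Fml          -- future diamond
  ◆     : Fml → Fml          -- past diamond (dual of ■)

data PurelyModal : Fml → Set where
  pm-atom : ∀ {a} → PurelyModal (atom a)
  pm-neg  : ∀ {a} → PurelyModal (neg a)
  pm-∨    : ∀ {A B} → PurelyModal A → PurelyModal B → PurelyModal (A ∨' B)
  pm-∧    : ∀ {A B} → PurelyModal A → PurelyModal B → PurelyModal (A ∧' B)
  pm-□    : ∀ {A} → PurelyModal A → PurelyModal (□ A)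
  pm-◇    : ∀ {A} → PurelyModal A → PurelyModal (◇ A)

-- Nested sequents: a sequent is a (multi)set of items; an item is a
-- formula, a white structure ∘{Γ} or a black structure •{Γ}.

data Item : Set where
  fml   : Fml → Item
  white : List Item → Item
  black : List Item → Item

Seq : Set
Seq = List Item

mutual
  data _≈ᵢ_ : Item → Item → Set where
    fml≈   : ∀ {A} → fml A ≈ᵢ fml A
    white≈ : ∀ {Γ Δ} → Γ ≈ Δ → white Γ ≈ᵢ white Δ
    black≈ : ∀ {Γ Δ} → Γ ≈ Δ → black Γ ≈ᵢ black Δ

  data _≈_ : Seq → Seq → Set where
    []≈   : [] ≈ []
    ∷≈    : ∀ {i j Γ Δ} → i ≈ᵢ j → Γ ≈ Δ → (i ∷ Γ) ≈ (j ∷ Δ)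
    swap≈ : ∀ {i j Γ} → (i ∷ j ∷ Γ) ≈ (j ∷ i ∷ Γ)
    trans≈ : ∀ {Γ Δ Θ} → Γ ≈ Δ → Δ ≈ Θ → Γ ≈ Θ

-- Contexts Σ[ ] with a hole at any depth.  The hole sits in a node
-- together with the remaining items Δ of that node.
data Ctx : Set where
  top   : Seq → Ctx
  inW   : Seq → Ctx → Ctx
  inB   : Seq → Ctx → Ctx

plug : Ctx → Seq → Seq
plug (top Δ)   Γ = Δ ++ Γ
plug (inW Δ C) Γ = Δ ++ [ white (plug C Γ) ]
plug (inB Δ C) Γ = Δ ++ [ black (plug C Γ) ]

-- The calculus DKS4 (sequents are multisets: derivability is taken
-- modulo multiset equivalence, rule `mset`)

data DKS4 : Seq → Set where
  mset : ∀ {Γ Δ} → Γ ≈ Δ → DKS4 Γ → DKS4 Δ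
  id   : ∀ C a → DKS4 (plug C (fml (atom a) ∷ fml (neg a) ∷ []))
  ∧r   : ∀ C A B → DKS4 (plug C (fml (A ∧' B) ∷ fml A ∷ []))
                 → DKS4 (plug C (fml (A ∧' B) ∷ fml B ∷ []))
                 → DKS4 (plug C (fml (A ∧' B) ∷ []))
  ∨r   : ∀ C A B → DKS4 (plug C (fml (A ∨' B) ∷ fml A ∷ fml B ∷ []))
                 → DKS4 (plug C (fml (A ∨' B) ∷ []))
  □r   : ∀ C A → DKS4 (plug C (fml (□ A) ∷ white (fml A ∷ []) ∷ []))
               → DKS4 (plug C (fml (□ A) ∷ []))
  ◇₁r  : ∀ C Δ A → DKS4 (plug C (white (Δ ++ fml A ∷ []) ∷ fml (◇ A) ∷ []))
                 → DKS4 (plug C (white Δ ∷ fml (◇ A) ∷ []))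
  Tb   : ∀ C A → DKS4 (plug C (fml (◇ A) ∷ fml A ∷ []))
               → DKS4 (plug C (fml (◇ A) ∷ []))
  4c   : ∀ C Δ A → DKS4 (plug C (fml (◇ A) ∷ white (fml (◇ A) ∷ Δ) ∷ []))
                 → DKS4 (plug C (fml (◇ A) ∷ white Δ ∷ []))

data MFml : Set where
  var  : ℕ → MFml
  ⊥'   : MFml
  _⇒_  : MFml → MFml → MFml
  ▢    : MFml → MFml

infixr 5 _⇒_

¬' : MFml → MFml
¬' A = A ⇒ ⊥'

data S4⊢_ : MFml → Set where
  ax-K  : ∀ A B → S4⊢ (A ⇒ B ⇒ A)
  ax-S  : ∀ A B C → S4⊢ ((A ⇒ B ⇒ C) ⇒ (A ⇒ B) ⇒ A ⇒ C)
  ax-DN : ∀ A → S4⊢ (¬' (¬' A) ⇒ A)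
  ax-□K : ∀ A B → S4⊢ (▢ (A ⇒ B) ⇒ ▢ A ⇒ ▢ B)
  ax-T  : ∀ A → S4⊢ (▢ A ⇒ A)
  ax-4  : ∀ A → S4⊢ (▢ A ⇒ ▢ (▢ A))
  mp    : ∀ {A B} → S4⊢ (A ⇒ B) → S4⊢ A → S4⊢ B
  nec   : ∀ {A} → S4⊢ A → S4⊢ ▢ A

⟦_⟧ : ∀ {A} → PurelyModal A → MFml
⟦ pm-atom {a} ⟧ = var a
⟦ pm-neg {a} ⟧  = ¬' (var a)
⟦ pm-∨ p q ⟧    = ¬' ⟦ p ⟧ ⇒ ⟦ q ⟧
⟦ pm-∧ p q ⟧    = ¬' (⟦ p ⟧ ⇒ ¬' ⟦ q ⟧)
⟦ pm-□ p ⟧      = ▢ ⟦ p ⟧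
⟦ pm-◇ p ⟧      = ¬' (▢ (¬' ⟦ p ⟧))

-- Both directions go through one finite proof search. On sets of subformulae of A, backward
-- search in DKS4 is taken in a restricted form: a □-step keeps only the ◇-formulae, which 4_c
-- copies into the new box. Derivability is the least fixpoint of a monotone operator on the
-- finitely many such sets, reached after finitely many stages, so it is decidable. A successful
-- search translates both into a DKS4 derivation and into an S4 derivation. Otherwise every
-- underivable set extends to a saturated underivable one; these sets, related when every
-- ◇-formula of the first lies in the second, form a reflexive transitive countermodel to A,
-- which by soundness refutes both S4 and DKS4 (read through the falsification semantics of
-- nested sequents). Valuations are stable, so the whole argument is constructive.

module Submission where

open import Defs
open import Data.Empty using (⊥; ⊥-elim)
open import Data.Fin using (Fin)
open import Data.Fin.Properties using (any?)
open import Data.Fin.Subset using (Subset; inside; outside; ⁅_⁆; _∪_; _⊂_; _⊃_)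
  renaming (⊥ to ∅; _∈_ to _∈ₛ_; _∉_ to _∉ₛ_; _⊆_ to _⊆ₛ_)
open import Data.Fin.Subset.Properties
  using (_∈?_; ∉⊥; x∈⁅x⁆; x∈⁅y⁆⇒x≡y; p⊆p∪q; q⊆p∪q; x∈p∪q⁻; ⊂-⊆-trans)
open import Data.Fin.Subset.Induction using (Acc; acc; ⊃-wellFounded)
open import Data.List using (List; []; _∷_; _++_; [_]; map; filter; length; lookup; allFin)
open import Data.List.Membership.Propositional using (_∈_)
open import Data.List.Membership.Propositional.Properties
  using (∈-++⁺ˡ; ∈-++⁺ʳ; ∈-++⁻; ∈-map⁺; ∈-map⁻; ∈-lookup; ∈-allFin; ∈-map∘filter⁺; ∈-map∘filter⁻)
open import Data.List.Properties using (++-assoc)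
open import Data.List.Relation.Binary.Subset.Propositional using (_⊆_)
open import Data.List.Relation.Binary.Subset.Propositional.Properties using (xs⊆xs++ys; ++⁺ʳ)
open import Data.List.Relation.Unary.Any using (here; there; index)
open import Data.List.Relation.Unary.Any.Properties using (lookup-index)
open import Data.Nat using (ℕ; zero; suc)
open import Data.Nat.Properties using (_≟_)
open import Data.Product using (Σ; ∃; _×_; _,_; proj₁; proj₂)
open import Data.Sum using (_⊎_; inj₁; inj₂; [_,_]′)
open import Data.Unit using (⊤; tt)
open import Data.Vec using ([]; _∷_; tabulate)
open import Data.Vec.Properties using (lookup∘tabulate; []=⇒lookup; lookup⇒[]=)
open import Function using (_∘_)
open import Function.Bundles using (_⇔_; mk⇔)
open import Relation.Binary.PropositionalEquality using (_≡_; refl; sym; trans; cong; cong₂; subst)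
open import Relation.Nullary using (¬_; Dec; yes; no; does)
open import Relation.Nullary.Decidable
  using (_×-dec_; _⊎-dec_; ¬?; map′; dec-true; decidable-stable)
open import Relation.Nullary.Negation using (negated-stable)
open import Relation.Unary using (Pred; Decidable)
open import Level using (0ℓ)

-- ■ and ◆ are read as □ and ◇; no rule of DKS4 inspects them, so any reading would do.
⌜_⌝ : Fml → MFml
⌜ atom a ⌝  = var a
⌜ neg a ⌝   = ¬' (var a)
⌜ A ∨' B ⌝  = ¬' ⌜ A ⌝ ⇒ ⌜ B ⌝
⌜ A ∧' B ⌝  = ¬' (⌜ A ⌝ ⇒ ¬' ⌜ B ⌝)
⌜ □ A ⌝     = ▢ ⌜ A ⌝
⌜ ■ A ⌝     = ▢ ⌜ A ⌝
⌜ ◇ A ⌝     = ¬' (▢ (¬' ⌜ A ⌝))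
⌜ ◆ A ⌝     = ¬' (▢ (¬' ⌜ A ⌝))

⌜⌝≡⟦⟧ : ∀ {A} (m : PurelyModal A) → ⌜ A ⌝ ≡ ⟦ m ⟧
⌜⌝≡⟦⟧ pm-atom    = refl
⌜⌝≡⟦⟧ pm-neg     = refl
⌜⌝≡⟦⟧ (pm-∨ p q) = cong₂ (λ x y → ¬' x ⇒ y) (⌜⌝≡⟦⟧ p) (⌜⌝≡⟦⟧ q)
⌜⌝≡⟦⟧ (pm-∧ p q) = cong₂ (λ x y → ¬' (x ⇒ ¬' y)) (⌜⌝≡⟦⟧ p) (⌜⌝≡⟦⟧ q)
⌜⌝≡⟦⟧ (pm-□ p)   = cong ▢ (⌜⌝≡⟦⟧ p)
⌜⌝≡⟦⟧ (pm-◇ p)   = cong (λ x → ¬' (▢ (¬' x))) (⌜⌝≡⟦⟧ p)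

mutual
  ≈ᵢ-refl : ∀ i → i ≈ᵢ i
  ≈ᵢ-refl (fml A)   = fml≈
  ≈ᵢ-refl (white Γ) = white≈ (≈-refl Γ)
  ≈ᵢ-refl (black Γ) = black≈ (≈-refl Γ)

  ≈-refl : ∀ Γ → Γ ≈ Γ
  ≈-refl []      = []≈
  ≈-refl (i ∷ Γ) = ∷≈ (≈ᵢ-refl i) (≈-refl Γ)

mutual
  ≈ᵢ-sym : ∀ {i j} → i ≈ᵢ j → j ≈ᵢ i
  ≈ᵢ-sym fml≈       = fml≈
  ≈ᵢ-sym (white≈ e) = white≈ (≈-sym e)
  ≈ᵢ-sym (black≈ e) = black≈ (≈-sym e)

  ≈-sym : ∀ {Γ Δ} → Γ ≈ Δ → Δ ≈ Γ
  ≈-sym []≈           = []≈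
  ≈-sym (∷≈ e e')     = ∷≈ (≈ᵢ-sym e) (≈-sym e')
  ≈-sym swap≈         = swap≈
  ≈-sym (trans≈ e e') = trans≈ (≈-sym e') (≈-sym e)

≈-∷ : ∀ i {Γ Δ} → Γ ≈ Δ → (i ∷ Γ) ≈ (i ∷ Δ)
≈-∷ i = ∷≈ (≈ᵢ-refl i)

≈-++⁺ˡ : ∀ Θ {Γ Δ} → Γ ≈ Δ → (Θ ++ Γ) ≈ (Θ ++ Δ)
≈-++⁺ˡ []      e = e
≈-++⁺ˡ (i ∷ Θ) e = ≈-∷ i (≈-++⁺ˡ Θ e)

≈-++⁺ʳ : ∀ Θ {Γ Δ} → Γ ≈ Δ → (Γ ++ Θ) ≈ (Δ ++ Θ)
≈-++⁺ʳ Θ []≈           = ≈-refl Θ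
≈-++⁺ʳ Θ (∷≈ e e')     = ∷≈ e (≈-++⁺ʳ Θ e')
≈-++⁺ʳ Θ swap≈         = swap≈
≈-++⁺ʳ Θ (trans≈ e e') = trans≈ (≈-++⁺ʳ Θ e) (≈-++⁺ʳ Θ e')

≈-∷ʳ : ∀ i Γ → (i ∷ Γ) ≈ (Γ ++ [ i ])
≈-∷ʳ i []      = ≈-refl [ i ]
≈-∷ʳ i (j ∷ Γ) = trans≈ swap≈ (≈-∷ j (≈-∷ʳ i Γ))

∈-resp-≈ : ∀ {A Γ Δ} → Γ ≈ Δ → fml A ∈ Γ → fml A ∈ Δ
∈-resp-≈ (∷≈ fml≈ e)   (here refl)         = here refl
∈-resp-≈ (∷≈ _ e)      (there p)           = there (∈-resp-≈ e p)
∈-resp-≈ swap≈         (here refl)         = there (here refl)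
∈-resp-≈ swap≈         (there (here refl)) = here refl
∈-resp-≈ swap≈         (there (there p))   = there (there p)
∈-resp-≈ (trans≈ e e') p                   = ∈-resp-≈ e' (∈-resp-≈ e p)

focus : ∀ {i Γ} → i ∈ Γ → ∃ λ Γ₁ → Γ ≈ (Γ₁ ++ [ i ])
focus {Γ = i ∷ Γ} (here refl) = Γ , ≈-∷ʳ i Γ
focus {Γ = j ∷ Γ} (there p)   = let Γ₁ , e = focus p in j ∷ Γ₁ , ≈-∷ j e

focus-++ : ∀ {Γ Γ₁ i} Δ → Γ ≈ (Γ₁ ++ [ i ]) → (Γ ++ Δ) ≈ (Γ₁ ++ i ∷ Δ)
focus-++ {Γ} {Γ₁} {i} Δ e = subst ((Γ ++ Δ) ≈_) (++-assoc Γ₁ [ i ] Δ) (≈-++⁺ʳ Δ e)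

infix 3 _⊢_
data _⊢_ (H : List MFml) : MFml → Set where
  hyp : ∀ {A} → A ∈ H → H ⊢ A
  thm : ∀ {A} → S4⊢ A → H ⊢ A
  mp  : ∀ {A B} → H ⊢ (A ⇒ B) → H ⊢ A → H ⊢ B

⇒-refl : ∀ A → S4⊢ (A ⇒ A)
⇒-refl A = mp (mp (ax-S A (A ⇒ A) A) (ax-K A (A ⇒ A))) (ax-K A A)

⊢-deduction : ∀ {H A B} → (A ∷ H) ⊢ B → H ⊢ (A ⇒ B)
⊢-deduction {A = A} (hyp (here refl)) = thm (⇒-refl A)
⊢-deduction {A = A} (hyp (there p))   = mp (thm (ax-K _ A)) (hyp p)
⊢-deduction {A = A} (thm d)           = mp (thm (ax-K _ A)) (thm d)
⊢-deduction {A = A} (mp {C} {D} d e)  = mp (mp (thm (ax-S A C D)) (⊢-deduction d)) (⊢-deduction e)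

⊢-weaken : ∀ {H H' A} → H ⊆ H' → H ⊢ A → H' ⊢ A
⊢-weaken H⊆H' (hyp p)  = hyp (H⊆H' p)
⊢-weaken H⊆H' (thm d)  = thm d
⊢-weaken H⊆H' (mp d e) = mp (⊢-weaken H⊆H' d) (⊢-weaken H⊆H' e)

⊢-closed : ∀ {A} → [] ⊢ A → S4⊢ A
⊢-closed (thm d)  = d
⊢-closed (mp d e) = mp (⊢-closed d) (⊢-closed e)

⊢-by-contradiction : ∀ {H A} → (¬' A ∷ H) ⊢ ⊥' → H ⊢ A
⊢-by-contradiction {A = A} d = mp (thm (ax-DN A)) (⊢-deduction d)

Boxed : MFml → Set
Boxed A = S4⊢ (A ⇒ ▢ A)

⊢-□-intro : ∀ H {A} → (∀ {B} → B ∈ H → Boxed B) → H ⊢ A → H ⊢ ▢ A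
⊢-□-intro []      boxed d = thm (nec (⊢-closed d))
⊢-□-intro (B ∷ H) {A} boxed d =
  mp (mp (thm (ax-□K B A)) (⊢-weaken there (⊢-□-intro H (boxed ∘ there) (⊢-deduction d))))
     (mp (thm (boxed (here refl))) (hyp (here refl)))

-- By axiom 4: ¬¬□X proves □X, hence □□X, hence □¬¬□X.
¬¬□-boxed : ∀ X → Boxed (¬' (¬' (▢ X)))
¬¬□-boxed X = ⊢-closed (⊢-deduction
  (mp (mp (thm (ax-□K (▢ X) (¬' (¬' (▢ X)))))
          (thm (nec (⊢-closed (⊢-deduction (⊢-deduction
            (mp (hyp (here refl)) (hyp (there (here refl))))))))))
      (mp (thm (ax-4 X)) (mp (thm (ax-DN (▢ X))) (hyp (here refl))))))

-- Stable valuations make double-negation elimination valid without excluded middle.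
record S4Model : Set₁ where
  field
    W        : Set
    R        : W → W → Set
    V        : ℕ → W → Set
    V-stable : ∀ a w → ¬ ¬ V a w → V a w
    R-refl   : ∀ w → R w w
    R-trans  : ∀ {u v w} → R u v → R v w → R u w

module Semantics (𝓜 : S4Model) where
  open S4Model 𝓜

  infix 4 _⊩_ _⊭ᵢ_ _⊭_

  _⊩_ : W → MFml → Set
  w ⊩ var a   = V a w
  w ⊩ ⊥'      = ⊥
  w ⊩ (A ⇒ B) = w ⊩ A → w ⊩ B
  w ⊩ ▢ A     = ∀ v → R w v → v ⊩ A

  ⊩-stable : ∀ A w → ¬ ¬ (w ⊩ A) → w ⊩ A
  ⊩-stable (var a) w h   = V-stable a w h
  ⊩-stable ⊥' w h        = h (λ x → x)
  ⊩-stable (A ⇒ B) w h a = ⊩-stable B w (λ ¬b → h (λ f → ¬b (f a)))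
  ⊩-stable (▢ A) w h v r = ⊩-stable A v (λ ¬a → h (λ f → ¬a (f v r)))

  S4-sound : ∀ {A} → S4⊢ A → ∀ w → w ⊩ A
  S4-sound (ax-K A B) w a b              = a
  S4-sound (ax-S A B C) w f g a          = f a (g a)
  S4-sound (ax-DN A) w                   = ⊩-stable A w
  S4-sound (ax-□K A B) w f g v r         = f v r (g v r)
  S4-sound (ax-T A) w f                  = f w (R-refl w)
  S4-sound (ax-4 A) w f v r u r'         = f u (R-trans r r')
  S4-sound (mp d e) w                    = S4-sound d w (S4-sound e w)
  S4-sound (nec d) w v r                 = S4-sound d v

  mutual
    _⊭ᵢ_ : W → Item → Set
    w ⊭ᵢ fml A   = ¬ (w ⊩ ⌜ A ⌝)
    w ⊭ᵢ white Γ = ∃ λ v → R w v × v ⊭ Γ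
    w ⊭ᵢ black Γ = ∃ λ v → R v w × v ⊭ Γ

    _⊭_ : W → Seq → Set
    w ⊭ []      = ⊤
    w ⊭ (i ∷ Γ) = w ⊭ᵢ i × w ⊭ Γ

  mutual
    ⊭ᵢ-resp-≈ : ∀ {i j} → i ≈ᵢ j → ∀ {w} → w ⊭ᵢ i → w ⊭ᵢ j
    ⊭ᵢ-resp-≈ fml≈       f               = f
    ⊭ᵢ-resp-≈ (white≈ e) (v , r , f)     = v , r , ⊭-resp-≈ e f
    ⊭ᵢ-resp-≈ (black≈ e) (v , r , f)     = v , r , ⊭-resp-≈ e f

    ⊭-resp-≈ : ∀ {Γ Δ} → Γ ≈ Δ → ∀ {w} → w ⊭ Γ → w ⊭ Δ
    ⊭-resp-≈ []≈           f             = f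
    ⊭-resp-≈ (∷≈ e e')     (f , g)       = ⊭ᵢ-resp-≈ e f , ⊭-resp-≈ e' g
    ⊭-resp-≈ swap≈         (f , g , h)   = g , f , h
    ⊭-resp-≈ (trans≈ e e') f             = ⊭-resp-≈ e' (⊭-resp-≈ e f)

  ⊭-++⁻ : ∀ Γ {Δ w} → w ⊭ (Γ ++ Δ) → w ⊭ Γ × w ⊭ Δ
  ⊭-++⁻ []      f       = tt , f
  ⊭-++⁻ (i ∷ Γ) (f , g) = let fΓ , fΔ = ⊭-++⁻ Γ g in (f , fΓ) , fΔ

  ⊭-++⁺ : ∀ Γ {Δ w} → w ⊭ Γ → w ⊭ Δ → w ⊭ (Γ ++ Δ)
  ⊭-++⁺ []      _       g = g
  ⊭-++⁺ (i ∷ Γ) (f , fΓ) g = f , ⊭-++⁺ Γ fΓ g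

  ⊭-plug : ∀ C {X w} → w ⊭ plug C X → ∃ λ v → v ⊭ X × (∀ {Y} → v ⊭ Y → w ⊭ plug C Y)
  ⊭-plug (top Δ) {w = w} f = let fΔ , fX = ⊭-++⁻ Δ f in w , fX , ⊭-++⁺ Δ fΔ
  ⊭-plug (inW Δ C) f with ⊭-++⁻ Δ f
  ... | fΔ , (u , r , g) , tt =
    let v , fX , back = ⊭-plug C g in v , fX , λ fY → ⊭-++⁺ Δ fΔ ((u , r , back fY) , tt)
  ⊭-plug (inB Δ C) f with ⊭-++⁻ Δ f
  ... | fΔ , (u , r , g) , tt =
    let v , fX , back = ⊭-plug C g in v , fX , λ fY → ⊭-++⁺ Δ fΔ ((u , r , back fY) , tt)

  DKS4-sound : ∀ {Γ} → DKS4 Γ → ∀ w → ¬ (w ⊭ Γ)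
  DKS4-sound (mset e d) w f = DKS4-sound d w (⊭-resp-≈ (≈-sym e) f)
  DKS4-sound (id C a) w f with ⊭-plug C f
  ... | v , (¬a , ¬¬a , tt) , back = ¬¬a ¬a
  DKS4-sound (∧r C A B d₁ d₂) w f with ⊭-plug C f
  ... | v , (¬ab , tt) , back =
    ¬ab (λ g → ¬A (λ a → ¬B (λ b → g a b)))
    where
      ¬A : ¬ ¬ (v ⊩ ⌜ A ⌝)
      ¬A ¬a = DKS4-sound d₁ w (back (¬ab , ¬a , tt))
      ¬B : ¬ ¬ (v ⊩ ⌜ B ⌝)
      ¬B ¬b = DKS4-sound d₂ w (back (¬ab , ¬b , tt))
  DKS4-sound (∨r C A B d) w f with ⊭-plug C f
  ... | v , (¬ab , tt) , back =
    DKS4-sound d w (back (¬ab , (λ a → ¬ab (λ ¬a → ⊥-elim (¬a a))) , (λ b → ¬ab (λ _ → b)) , tt))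
  DKS4-sound (□r C A d) w f with ⊭-plug C f
  ... | v , (¬□a , tt) , back =
    ¬□a (λ u r → ⊩-stable ⌜ A ⌝ u (λ ¬a → DKS4-sound d w (back (¬□a , (u , r , ¬a , tt) , tt))))
  DKS4-sound (◇₁r C Δ A d) w f with ⊭-plug C f
  ... | v , ((u , r , fΔ) , ¬◇a , tt) , back =
    DKS4-sound d w (back ((u , r , ⊭-++⁺ Δ fΔ ((λ a → ¬◇a (λ h → h u r a)) , tt)) , ¬◇a , tt))
  DKS4-sound (Tb C A d) w f with ⊭-plug C f
  ... | v , (¬◇a , tt) , back =
    DKS4-sound d w (back (¬◇a , (λ a → ¬◇a (λ h → h v (R-refl v) a)) , tt))
  DKS4-sound (4c C Δ A d) w f with ⊭-plug C f
  ... | v , (¬◇a , (u , r , fΔ) , tt) , back =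
    DKS4-sound d w (back (¬◇a , (u , r , ¬◇a-at-u , fΔ) , tt))
    where
      ¬◇a-at-u : ¬ (u ⊩ ⌜ ◇ A ⌝)
      ¬◇a-at-u ◇a = ¬◇a (λ h → ◇a (λ t r' → h t (R-trans r r')))

_∘ᶜ_ : Ctx → Ctx → Ctx
top Δ   ∘ᶜ top Δ'   = top (Δ ++ Δ')
top Δ   ∘ᶜ inW Δ' C = inW (Δ ++ Δ') C
top Δ   ∘ᶜ inB Δ' C = inB (Δ ++ Δ') C
inW Δ C ∘ᶜ C'       = inW Δ (C ∘ᶜ C')
inB Δ C ∘ᶜ C'       = inB Δ (C ∘ᶜ C')

plug-∘ᶜ : ∀ C C' X → plug C (plug C' X) ≡ plug (C ∘ᶜ C') X
plug-∘ᶜ (top Δ)   (top Δ')   X = sym (++-assoc Δ Δ' X)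
plug-∘ᶜ (top Δ)   (inW Δ' C) X = sym (++-assoc Δ Δ' _)
plug-∘ᶜ (top Δ)   (inB Δ' C) X = sym (++-assoc Δ Δ' _)
plug-∘ᶜ (inW Δ C) C'         X = cong (λ Z → Δ ++ [ white Z ]) (plug-∘ᶜ C C' X)
plug-∘ᶜ (inB Δ C) C'         X = cong (λ Z → Δ ++ [ black Z ]) (plug-∘ᶜ C C' X)

plug-resp-≈ : ∀ C {Γ Δ} → Γ ≈ Δ → plug C Γ ≈ plug C Δ
plug-resp-≈ (top Δ)   e = ≈-++⁺ˡ Δ e
plug-resp-≈ (inW Δ C) e = ≈-++⁺ˡ Δ (∷≈ (white≈ (plug-resp-≈ C e)) []≈)
plug-resp-≈ (inB Δ C) e = ≈-++⁺ˡ Δ (∷≈ (black≈ (plug-resp-≈ C e)) []≈)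

via-∘ᶜ : ∀ C C' {X Y} → (DKS4 (plug (C ∘ᶜ C') X) → DKS4 (plug (C ∘ᶜ C') Y))
       → DKS4 (plug C (plug C' X)) → DKS4 (plug C (plug C' Y))
via-∘ᶜ C C' {X} {Y} rule rewrite plug-∘ᶜ C C' X | plug-∘ᶜ C C' Y = rule

DKS4-plug : ∀ C {Γ} → DKS4 Γ → DKS4 (plug C Γ)
DKS4-plug C (mset e d)          = mset (plug-resp-≈ C e) (DKS4-plug C d)
DKS4-plug C (id C' a)           = subst DKS4 (sym (plug-∘ᶜ C C' _)) (id (C ∘ᶜ C') a)
DKS4-plug C (∧r C' A B d₁ d₂)   =
  via-∘ᶜ C C' (∧r (C ∘ᶜ C') A B (subst DKS4 (plug-∘ᶜ C C' _) (DKS4-plug C d₁))) (DKS4-plug C d₂)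
DKS4-plug C (∨r C' A B d)       = via-∘ᶜ C C' (∨r (C ∘ᶜ C') A B) (DKS4-plug C d)
DKS4-plug C (□r C' A d)         = via-∘ᶜ C C' (□r (C ∘ᶜ C') A) (DKS4-plug C d)
DKS4-plug C (◇₁r C' Δ A d)      = via-∘ᶜ C C' (◇₁r (C ∘ᶜ C') Δ A) (DKS4-plug C d)
DKS4-plug C (Tb C' A d)         = via-∘ᶜ C C' (Tb (C ∘ᶜ C') A) (DKS4-plug C d)
DKS4-plug C (4c C' Δ A d)       = via-∘ᶜ C C' (4c (C ∘ᶜ C') Δ A) (DKS4-plug C d)

focus-on : ∀ {F Γ} → fml F ∈ Γ
         → (∀ Γ₁ → (∀ {Δ A} → fml A ∈ Γ → fml A ∈ Γ₁ ++ fml F ∷ Δ) → DKS4 (Γ₁ ++ [ fml F ]))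
         → DKS4 Γ
focus-on p rule with Γ₁ , e ← focus p =
  mset (≈-sym e) (rule Γ₁ (++⁺ʳ Γ₁ (xs⊆xs++ys _ _) ∘ ∈-resp-≈ e))

IsDiamond : Fml → Set
IsDiamond F = ∃ λ A → F ≡ ◇ A

4c* : ∀ Ds Δ O → (∀ {D} → D ∈ Ds → IsDiamond D × fml D ∈ O)
    → DKS4 (O ++ [ white (map fml Ds ++ Δ) ]) → DKS4 (O ++ [ white Δ ])
4c* []       Δ O ds d = d
4c* (D ∷ Ds) Δ O ds d with ds (here refl)
... | (A , refl) , p with O₁ , e ← focus p =
  4c* Ds Δ O (ds ∘ there)
    (mset (≈-sym (focus-++ _ e)) (4c (top O₁) (map fml Ds ++ Δ) A (mset (focus-++ _ e) d)))

subsetOf : ∀ {n} {P : Pred (Fin n) 0ℓ} → Decidable P → Subset n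
subsetOf P? = tabulate (does ∘ P?)

module _ {n} {P : Pred (Fin n) 0ℓ} (P? : Decidable P) {i : Fin n} where

  ∈-subsetOf⁺ : P i → i ∈ₛ subsetOf P?
  ∈-subsetOf⁺ Pi = lookup⇒[]= i _ (trans (lookup∘tabulate _ i) (dec-true (P? i) Pi))

  ∈-subsetOf⁻ : i ∈ₛ subsetOf P? → P i
  ∈-subsetOf⁻ i∈ with P? i | trans (sym ([]=⇒lookup i∈)) (lookup∘tabulate (does ∘ P?) i)
  ... | yes Pi | _  = Pi
  ... | no _   | ()

allSubsets : ∀ n → List (Subset n)
allSubsets zero    = [ [] ]
allSubsets (suc n) = map (inside ∷_) (allSubsets n) ++ map (outside ∷_) (allSubsets n)

∈-allSubsets : ∀ {n} (w : Subset n) → w ∈ allSubsets n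
∈-allSubsets []            = here refl
∈-allSubsets (inside ∷ w)  = ∈-++⁺ˡ (∈-map⁺ (inside ∷_) (∈-allSubsets w))
∈-allSubsets (outside ∷ w) = ∈-++⁺ʳ _ (∈-map⁺ (outside ∷_) (∈-allSubsets w))

⊆-chain-stabilises : ∀ {m} (s : ℕ → Subset m) → (∀ k → s k ⊆ₛ s (suc k))
                   → ∃ λ N → s (suc N) ⊆ₛ s N
⊆-chain-stabilises s ascending = go 0 (⊃-wellFounded (s 0))
  where
    go : ∀ k → Acc _⊃_ (s k) → ∃ λ N → s (suc N) ⊆ₛ s N
    go k (acc rs) with any? (λ x → x ∈? s (suc k) ×-dec ¬? (x ∈? s k))
    ... | yes new = go (suc k) (rs (ascending k , new))
    ... | no ¬new = k , λ {x} x∈ → decidable-stable (x ∈? s k) (λ x∉ → ¬new (x , x∈ , x∉))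

decidable-chain-stabilises :
  ∀ {X : Set} (xs : List X) → (∀ x → x ∈ xs) →
  (P : ℕ → X → Set) → (∀ k → Decidable (P k)) → (∀ k {x} → P k x → P (suc k) x) →
  ∃ λ N → ∀ {x} → P (suc N) x → P N x
decidable-chain-stabilises xs enum P P? ascending =
  let N , stable = ⊆-chain-stabilises χ χ-ascending in N , stable-at N stable
  where
    P?ᵢ : ∀ k → Decidable (P k ∘ lookup xs)
    P?ᵢ k i = P? k (lookup xs i)

    χ : ℕ → Subset (length xs)
    χ k = subsetOf (P?ᵢ k)

    χ-ascending : ∀ k → χ k ⊆ₛ χ (suc k)
    χ-ascending k = ∈-subsetOf⁺ (P?ᵢ (suc k)) ∘ ascending k ∘ ∈-subsetOf⁻ (P?ᵢ k)

    stable-at : ∀ N → χ (suc N) ⊆ₛ χ N → ∀ {x} → P (suc N) x → P N x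
    stable-at N stable {x} Px =
      subst (P N) (sym x≡)
        (∈-subsetOf⁻ (P?ᵢ N) (stable (∈-subsetOf⁺ (P?ᵢ (suc N)) (subst (P (suc N)) x≡ Px))))
      where x≡ = lookup-index (enum x)

≟-neg : ∀ F a → Dec (F ≡ neg a)
≟-neg (neg b)  a = map′ (cong neg) (λ { refl → refl }) (b ≟ a)
≟-neg (atom _) _ = no λ ()
≟-neg (_ ∨' _) _ = no λ ()
≟-neg (_ ∧' _) _ = no λ ()
≟-neg (□ _)    _ = no λ ()
≟-neg (■ _)    _ = no λ ()
≟-neg (◇ _)    _ = no λ ()
≟-neg (◆ _)    _ = no λ ()

isDiamond? : ∀ F → Dec (IsDiamond F)
isDiamond? (◇ A)    = yes (A , refl)
isDiamond? (atom _) = no λ { (_ , ()) }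
isDiamond? (neg _)  = no λ { (_ , ()) }
isDiamond? (_ ∨' _) = no λ { (_ , ()) }
isDiamond? (_ ∧' _) = no λ { (_ , ()) }
isDiamond? (□ _)    = no λ { (_ , ()) }
isDiamond? (■ _)    = no λ { (_ , ()) }
isDiamond? (◆ _)    = no λ { (_ , ()) }

diamond-boxed : ∀ {D} → IsDiamond D → Boxed (¬' ⌜ D ⌝)
diamond-boxed (A , refl) = ¬¬□-boxed (¬' ⌜ A ⌝)

record SubformulaClosed (S : List Fml) : Set where
  field
    ∨⁻ˡ : ∀ {A B} → A ∨' B ∈ S → A ∈ S
    ∨⁻ʳ : ∀ {A B} → A ∨' B ∈ S → B ∈ S
    ∧⁻ˡ : ∀ {A B} → A ∧' B ∈ S → A ∈ S
    ∧⁻ʳ : ∀ {A B} → A ∧' B ∈ S → B ∈ S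
    □⁻  : ∀ {A} → □ A ∈ S → A ∈ S
    ◇⁻  : ∀ {A} → ◇ A ∈ S → A ∈ S

Refutable : MFml → Set₁
Refutable A = Σ S4Model λ 𝓜 → Σ (S4Model.W 𝓜) λ w → ¬ Semantics._⊩_ 𝓜 w A

module ProofSearch (S : List Fml) (closed : SubformulaClosed S) where
  open SubformulaClosed closed

  n : ℕ
  n = length S

  φ : Fin n → Fml
  φ = lookup S

  φ∈S : ∀ j → φ j ∈ S
  φ∈S = ∈-lookup

  infix 4 _∋_
  _∋_ : Subset n → Fml → Set
  w ∋ A = ∃ λ j → j ∈ₛ w × φ j ≡ A

  index-∋ : ∀ {w A} (p : A ∈ S) → index p ∈ₛ w → w ∋ A
  index-∋ p i∈ = index p , i∈ , sym (lookup-index p)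

  infixl 6 _⊕_
  _⊕_ : ∀ {A} → Subset n → A ∈ S → Subset n
  w ⊕ p = w ∪ ⁅ index p ⁆

  ⊆-⊕ : ∀ {w A} (p : A ∈ S) → w ⊆ₛ w ⊕ p
  ⊆-⊕ p = p⊆p∪q _

  ∈-⊕ : ∀ {w A} (p : A ∈ S) → index p ∈ₛ w ⊕ p
  ∈-⊕ {w} p = q⊆p∪q w _ (x∈⁅x⁆ (index p))

  ⊂-⊕ : ∀ {w A} (p : A ∈ S) → index p ∉ₛ w → w ⊂ w ⊕ p
  ⊂-⊕ p i∉ = ⊆-⊕ p , index p , ∈-⊕ p , i∉

  ◇-part : Subset n → Subset n
  ◇-part w = subsetOf (λ j → j ∈? w ×-dec isDiamond? (φ j))

  ◇-part⁺ : ∀ {w j} → j ∈ₛ w → IsDiamond (φ j) → j ∈ₛ ◇-part w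
  ◇-part⁺ {w} j∈ d = ∈-subsetOf⁺ (λ j → j ∈? w ×-dec isDiamond? (φ j)) (j∈ , d)

  ◇-part⁻ : ∀ {w j} → j ∈ₛ ◇-part w → j ∈ₛ w × IsDiamond (φ j)
  ◇-part⁻ {w} = ∈-subsetOf⁻ (λ j → j ∈? w ×-dec isDiamond? (φ j))

  formulas : Subset n → List Fml
  formulas w = map φ (filter (_∈? w) (allFin n))

  ∈-formulas⁺ : ∀ {w j} → j ∈ₛ w → φ j ∈ formulas w
  ∈-formulas⁺ {w} {j} j∈ = ∈-map∘filter⁺ φ (_∈? w) (j , ∈-allFin j , refl , j∈)

  ∈-◇-formulas⁻ : ∀ {w D} → D ∈ formulas (◇-part w) → w ∋ D × IsDiamond D
  ∈-◇-formulas⁻ {w} D∈ with j , _ , refl , j∈ ← ∈-map∘filter⁻ φ (_∈? ◇-part w) {xs = allFin n} D∈ =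
    let j∈w , d = ◇-part⁻ j∈ in (j , j∈w , refl) , d

  Covers : ∀ {X : Set} → (Fml → X) → List X → Subset n → Set
  Covers f Γ w = ∀ {j} → j ∈ₛ w → f (φ j) ∈ Γ

  module _ {X : Set} {f : Fml → X} {Γ : List X} where

    covers-∋ : ∀ {w A} → Covers f Γ w → w ∋ A → f A ∈ Γ
    covers-∋ cov (j , j∈ , refl) = cov j∈

    covers-⊕ : ∀ {w A} (p : A ∈ S) → f A ∈ Γ → Covers f Γ w → Covers f Γ (w ⊕ p)
    covers-⊕ {w} p fA cov j∈ with x∈p∪q⁻ w _ j∈
    ... | inj₁ j∈w = cov j∈w
    ... | inj₂ j∈⁅⁆ with refl ← x∈⁅y⁆⇒x≡y (index p) j∈⁅⁆ = subst (λ B → f B ∈ Γ) (lookup-index p) fA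

  covers-singleton : ∀ {X : Set} {f : Fml → X} {A} (p : A ∈ S) → Covers f [ f A ] (∅ ⊕ p)
  covers-singleton p = covers-⊕ p (here refl) (⊥-elim ∘ ∉⊥)

  -- A □-step keeps only the ◇-formulae of w, as □ followed by 4_c on each of them does.
  Rule : (Subset n → Set) → Subset n → ∀ {A} → A ∈ S → Set
  Rule D w {atom a} _ = w ∋ neg a
  Rule D w {A ∨' B} p = D (w ⊕ ∨⁻ˡ p ⊕ ∨⁻ʳ p)
  Rule D w {A ∧' B} p = D (w ⊕ ∧⁻ˡ p) × D (w ⊕ ∧⁻ʳ p)
  Rule D w {□ A}    p = D (◇-part w ⊕ □⁻ p)
  Rule D w {◇ A}    p = D (w ⊕ ◇⁻ p)
  Rule D w {neg _}  _ = ⊥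
  Rule D w {■ _}    _ = ⊥
  Rule D w {◆ _}    _ = ⊥

  Der : ℕ → Subset n → Set
  Der zero    w = ⊥
  Der (suc k) w = ∃ λ j → j ∈ₛ w × Rule (Der k) w (φ∈S j)

  rule? : ∀ {D} → Decidable D → ∀ w {A} (p : A ∈ S) → Dec (Rule D w p)
  rule? D? w {atom a} p = any? (λ j → j ∈? w ×-dec ≟-neg (φ j) a)
  rule? D? w {A ∨' B} p = D? _
  rule? D? w {A ∧' B} p = D? _ ×-dec D? _
  rule? D? w {□ A}    p = D? _
  rule? D? w {◇ A}    p = D? _
  rule? D? w {neg _}  p = no λ ()
  rule? D? w {■ _}    p = no λ ()
  rule? D? w {◆ _}    p = no λ ()

  der? : ∀ k → Decidable (Der k)
  der? zero    w = no λ ()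
  der? (suc k) w = any? (λ j → j ∈? w ×-dec rule? (der? k) w (φ∈S j))

  rule-mono : ∀ {D D'} → (∀ {w} → D w → D' w) → ∀ {w A} (p : A ∈ S) → Rule D w p → Rule D' w p
  rule-mono D⇒D' {A = atom _} p r         = r
  rule-mono D⇒D' {A = _ ∨' _} p r         = D⇒D' r
  rule-mono D⇒D' {A = _ ∧' _} p (r₁ , r₂) = D⇒D' r₁ , D⇒D' r₂
  rule-mono D⇒D' {A = □ _}    p r         = D⇒D' r
  rule-mono D⇒D' {A = ◇ _}    p r         = D⇒D' r

  der-mono : ∀ k {w} → Der k w → Der (suc k) w
  der-mono (suc k) (j , j∈w , r) = j , j∈w , rule-mono (der-mono k) (φ∈S j) r

  private
    stage : ∃ λ N → ∀ {w} → Der (suc N) w → Der N w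
    stage = decidable-chain-stabilises (allSubsets n) ∈-allSubsets Der der? der-mono

  N : ℕ
  N = proj₁ stage

  Derivable : Subset n → Set
  Derivable = Der N

  derivable? : Decidable Derivable
  derivable? = der? N

  ¬derivable⇒¬rule : ∀ {w j} → ¬ Derivable w → j ∈ₛ w → ¬ Rule Derivable w (φ∈S j)
  ¬derivable⇒¬rule w̸ j∈w r = w̸ (proj₂ stage (_ , j∈w , r))

  Der⇒DKS4 : ∀ k {w Γ} → Der k w → Covers fml Γ w → DKS4 Γ
  Der⇒DKS4 (suc k) {w} {Γ} (j , j∈w , r) cov = by-rule (φ∈S j) r (cov j∈w)
    where
      by-rule : ∀ {F} (p : F ∈ S) → Rule (Der k) w p → fml F ∈ Γ → DKS4 Γ
      by-rule {atom a} p ¬a∈ a∈ = focus-on a∈ λ Γ₁ sub →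
        axiom Γ₁ (∈-++⁻ Γ₁ (sub (covers-∋ {f = fml} cov ¬a∈)))
        where
          axiom : ∀ Γ₁ → fml (neg a) ∈ Γ₁ ⊎ fml (neg a) ∈ [ fml (atom a) ]
                → DKS4 (Γ₁ ++ [ fml (atom a) ])
          axiom Γ₁ (inj₁ ¬a∈Γ₁) with Γ₂ , e ← focus ¬a∈Γ₁ =
            mset (≈-sym (trans≈ (focus-++ _ e) (≈-++⁺ˡ Γ₂ swap≈))) (id (top Γ₂) a)
          axiom Γ₁ (inj₂ (here ()))
          axiom Γ₁ (inj₂ (there ()))
      by-rule {A ∨' B} p r F∈ = focus-on F∈ λ Γ₁ sub →
        ∨r (top Γ₁) A B (Der⇒DKS4 k r
          (covers-⊕ (∨⁻ʳ p) (∈-++⁺ʳ Γ₁ (there (there (here refl))))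
            (covers-⊕ (∨⁻ˡ p) (∈-++⁺ʳ Γ₁ (there (here refl))) (sub ∘ cov))))
      by-rule {A ∧' B} p (r₁ , r₂) F∈ = focus-on F∈ λ Γ₁ sub →
        ∧r (top Γ₁) A B
          (Der⇒DKS4 k r₁ (covers-⊕ (∧⁻ˡ p) (∈-++⁺ʳ Γ₁ (there (here refl))) (sub ∘ cov)))
          (Der⇒DKS4 k r₂ (covers-⊕ (∧⁻ʳ p) (∈-++⁺ʳ Γ₁ (there (here refl))) (sub ∘ cov)))
      by-rule {◇ B} p r F∈ = focus-on F∈ λ Γ₁ sub →
        Tb (top Γ₁) B (Der⇒DKS4 k r (covers-⊕ (◇⁻ p) (∈-++⁺ʳ Γ₁ (there (here refl))) (sub ∘ cov)))
      by-rule {□ B} p r F∈ = focus-on F∈ λ Γ₁ sub →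
        let O = Γ₁ ++ [ fml (□ B) ]
            inner : DKS4 (map fml (formulas (◇-part w)) ++ [ fml B ])
            inner = Der⇒DKS4 k r (covers-⊕ (□⁻ p) (∈-++⁺ʳ _ (here refl))
                                   (λ i∈ → ∈-++⁺ˡ (∈-map⁺ fml (∈-formulas⁺ i∈))))
            diamonds-in-O : ∀ {D} → D ∈ formulas (◇-part w) → IsDiamond D × fml D ∈ O
            diamonds-in-O D∈ = let D∈w , d = ∈-◇-formulas⁻ D∈ in d , sub (covers-∋ cov D∈w)
        in □r (top Γ₁) B (subst DKS4 (++-assoc Γ₁ _ _)
             (4c* (formulas (◇-part w)) [ fml B ] O diamonds-in-O (DKS4-plug (inW O (top [])) inner)))

  Der⇒⊢ : ∀ k {w H} → Der k w → Covers (¬' ∘ ⌜_⌝) H w → H ⊢ ⊥'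
  Der⇒⊢ (suc k) {w} {H} (j , j∈w , r) cov = by-rule (φ∈S j) r (cov j∈w)
    where
      by-rule : ∀ {F} (p : F ∈ S) → Rule (Der k) w p → ¬' ⌜ F ⌝ ∈ H → H ⊢ ⊥'
      by-rule {atom a} p ¬a∈ F∈ = mp (hyp (covers-∋ {f = ¬' ∘ ⌜_⌝} cov ¬a∈)) (hyp F∈)
      by-rule {A ∨' B} p r F∈ =
        mp (hyp F∈) (⊢-deduction (⊢-by-contradiction (Der⇒⊢ k r
          (covers-⊕ (∨⁻ʳ p) (here refl)
            (covers-⊕ (∨⁻ˡ p) (there (here refl)) (there ∘ there ∘ cov))))))
      by-rule {A ∧' B} p (r₁ , r₂) F∈ =
        mp (hyp F∈) (⊢-deduction (mp (mp (hyp (here refl)) (⊢-weaken there ⊢A)) (⊢-weaken there ⊢B)))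
        where
          ⊢A : H ⊢ ⌜ A ⌝
          ⊢A = ⊢-by-contradiction (Der⇒⊢ k r₁ (covers-⊕ (∧⁻ˡ p) (here refl) (there ∘ cov)))
          ⊢B : H ⊢ ⌜ B ⌝
          ⊢B = ⊢-by-contradiction (Der⇒⊢ k r₂ (covers-⊕ (∧⁻ʳ p) (here refl) (there ∘ cov)))
      by-rule {◇ B} p r F∈ =
        mp (mp (thm (ax-T _)) (mp (thm (ax-DN _)) (hyp F∈)))
           (⊢-by-contradiction (Der⇒⊢ k r (covers-⊕ (◇⁻ p) (here refl) (there ∘ cov))))
      by-rule {□ B} p r F∈ =
        mp (hyp F∈) (⊢-weaken hs⊆H (⊢-□-intro hs hs-boxed (⊢-by-contradiction (Der⇒⊢ k r
          (covers-⊕ (□⁻ p) (here refl) (there ∘ ∈-map⁺ (¬' ∘ ⌜_⌝) ∘ ∈-formulas⁺))))))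
        where
          hs : List MFml
          hs = map (¬' ∘ ⌜_⌝) (formulas (◇-part w))
          hs⊆H : hs ⊆ H
          hs⊆H h∈ with D , D∈ , refl ← ∈-map⁻ (¬' ∘ ⌜_⌝) h∈ =
            covers-∋ cov (proj₁ (∈-◇-formulas⁻ D∈))
          hs-boxed : ∀ {h} → h ∈ hs → Boxed h
          hs-boxed h∈ with D , D∈ , refl ← ∈-map⁻ (¬' ∘ ⌜_⌝) h∈ =
            diamond-boxed (proj₂ (∈-◇-formulas⁻ D∈))

  Sat : Subset n → ∀ {A} → A ∈ S → Set
  Sat w {A ∨' B} p = index (∨⁻ˡ p) ∈ₛ w × index (∨⁻ʳ p) ∈ₛ w
  Sat w {A ∧' B} p = index (∧⁻ˡ p) ∈ₛ w ⊎ index (∧⁻ʳ p) ∈ₛ w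
  Sat w {◇ A}    p = index (◇⁻ p) ∈ₛ w
  Sat w {atom _} _ = ⊤
  Sat w {neg _}  _ = ⊤
  Sat w {□ _}    _ = ⊤
  Sat w {■ _}    _ = ⊤
  Sat w {◆ _}    _ = ⊤

  sat? : ∀ w {A} (p : A ∈ S) → Dec (Sat w p)
  sat? w {A ∨' B} p = (_ ∈? w) ×-dec (_ ∈? w)
  sat? w {A ∧' B} p = (_ ∈? w) ⊎-dec (_ ∈? w)
  sat? w {◇ A}    p = _ ∈? w
  sat? w {atom _} p = yes tt
  sat? w {neg _}  p = yes tt
  sat? w {□ _}    p = yes tt
  sat? w {■ _}    p = yes tt
  sat? w {◆ _}    p = yes tt

  Saturated : Subset n → Set
  Saturated w = ∀ {j} → j ∈ₛ w → Sat w (φ∈S j)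

  extend-unsaturated : ∀ {w j} → ¬ Derivable w → j ∈ₛ w → ¬ Sat w (φ∈S j)
                     → ∃ λ v → w ⊂ v × ¬ Derivable v
  extend-unsaturated {w} {j} w̸ j∈w ¬sat = by-formula (φ∈S j) ¬sat (¬derivable⇒¬rule w̸ j∈w)
    where
      by-formula : ∀ {A} (p : A ∈ S) → ¬ Sat w p → ¬ Rule Derivable w p
                 → ∃ λ v → w ⊂ v × ¬ Derivable v
      by-formula {A ∨' B} p ¬sat ¬rule with index (∨⁻ˡ p) ∈? w
      ... | no  l∉ = _ , ⊂-⊆-trans (⊂-⊕ (∨⁻ˡ p) l∉) (⊆-⊕ (∨⁻ʳ p)) , ¬rule
      ... | yes l∈ =
        _ , ((λ x∈ → ⊆-⊕ (∨⁻ʳ p) (⊆-⊕ (∨⁻ˡ p) x∈)) , _ , ∈-⊕ (∨⁻ʳ p) , λ r∈ → ¬sat (l∈ , r∈)) , ¬rule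
      by-formula {A ∧' B} p ¬sat ¬rule with derivable? (w ⊕ ∧⁻ˡ p)
      ... | no  l̸ = _ , ⊂-⊕ (∧⁻ˡ p) (¬sat ∘ inj₁) , l̸
      ... | yes l = _ , ⊂-⊕ (∧⁻ʳ p) (¬sat ∘ inj₂) , λ r → ¬rule (l , r)
      by-formula {◇ A}    p ¬sat ¬rule = _ , ⊂-⊕ (◇⁻ p) ¬sat , ¬rule
      by-formula {atom _} p ¬sat _ = ⊥-elim (¬sat tt)
      by-formula {neg _}  p ¬sat _ = ⊥-elim (¬sat tt)
      by-formula {□ _}    p ¬sat _ = ⊥-elim (¬sat tt)
      by-formula {■ _}    p ¬sat _ = ⊥-elim (¬sat tt)
      by-formula {◆ _}    p ¬sat _ = ⊥-elim (¬sat tt)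

  World : Set
  World = Σ (Subset n) λ w → ¬ Derivable w × Saturated w

  saturate : ∀ {w} → ¬ Derivable w → Σ World λ 𝔴 → w ⊆ₛ proj₁ 𝔴
  saturate {w} = go w (⊃-wellFounded w)
    where
      go : ∀ w → Acc _⊃_ w → ¬ Derivable w → Σ World λ 𝔴 → w ⊆ₛ proj₁ 𝔴
      go w (acc rs) w̸ with any? (λ j → j ∈? w ×-dec ¬? (sat? w (φ∈S j)))
      ... | yes (j , j∈w , ¬sat) =
        let v , w⊂v , v̸ = extend-unsaturated w̸ j∈w ¬sat
            𝔴 , v⊆𝔴 = go v (rs w⊂v) v̸
        in 𝔴 , λ x∈ → v⊆𝔴 (proj₁ w⊂v x∈)
      ... | no ¬unsat =
        (w , w̸ , λ {j} j∈w → decidable-stable (sat? w (φ∈S j)) (λ ¬sat → ¬unsat (j , j∈w , ¬sat)))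
        , λ x∈ → x∈

  canonical : S4Model
  canonical = record
    { W        = World
    ; R        = λ 𝔴 𝔳 → ◇-part (proj₁ 𝔴) ⊆ₛ proj₁ 𝔳
    ; V        = λ a 𝔴 → ¬ (proj₁ 𝔴 ∋ atom a)
    ; V-stable = λ _ _ → negated-stable
    ; R-refl   = λ _ j∈ → proj₁ (◇-part⁻ j∈)
    ; R-trans  = λ r₁ r₂ j∈ → r₂ (◇-part⁺ (r₁ j∈) (proj₂ (◇-part⁻ j∈)))
    }

  open Semantics canonical

  refuted-at : ∀ {w A} → ¬ Derivable w → w ∋ A → Σ (A ∈ S) λ p → ¬ Rule Derivable w p
  refuted-at w̸ (j , j∈w , refl) = φ∈S j , ¬derivable⇒¬rule w̸ j∈w

  saturated-at : ∀ {w A} → Saturated w → w ∋ A → Σ (A ∈ S) (Sat w)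
  saturated-at sat (j , j∈w , refl) = φ∈S j , sat j∈w

  ◇-preserved : ∀ {w v A} → ◇-part w ⊆ₛ v → w ∋ ◇ A → v ∋ ◇ A
  ◇-preserved r (j , j∈w , eq) = j , r (◇-part⁺ j∈w (_ , eq)) , eq

  truth : ∀ {A} (m : PurelyModal A) (𝔴 : World) → proj₁ 𝔴 ∋ A → ¬ (𝔴 ⊩ ⟦ m ⟧)
  truth pm-atom    𝔴 a∈ ⊩a = ⊩a a∈
  truth pm-neg     (w , w̸ , _) ¬a∈ ⊩¬a = ⊩¬a λ a∈ → proj₂ (refuted-at w̸ a∈) ¬a∈
  truth (pm-∨ p q) 𝔴@(_ , _ , sat) ∨∈ ⊩∨ with r , l∈ , r∈ ← saturated-at sat ∨∈ =
    truth q 𝔴 (index-∋ (∨⁻ʳ r) r∈) (⊩∨ (truth p 𝔴 (index-∋ (∨⁻ˡ r) l∈)))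
  truth (pm-∧ p q) 𝔴@(_ , _ , sat) ∧∈ ⊩∧ with r , s ← saturated-at sat ∧∈ =
    ⊩∧ λ a b → [ (λ l∈ → truth p 𝔴 (index-∋ (∧⁻ˡ r) l∈) a)
               , (λ r∈ → truth q 𝔴 (index-∋ (∧⁻ʳ r) r∈) b) ]′ s
  truth (pm-□ p)   (_ , w̸ , _) □∈ ⊩□
    with r , ¬rule ← refuted-at w̸ □∈ with 𝔳 , ⊆𝔳 ← saturate ¬rule =
    truth p 𝔳 (index-∋ (□⁻ r) (⊆𝔳 (∈-⊕ (□⁻ r)))) (⊩□ 𝔳 (λ j∈ → ⊆𝔳 (⊆-⊕ (□⁻ r) j∈)))
  truth (pm-◇ p)   𝔴 ◇∈ ⊩◇ = ⊩◇ λ 𝔳@(_ , _ , sat) r ⊩A →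
    let r′ , A∈ = saturated-at sat (◇-preserved r ◇∈) in truth p 𝔳 (index-∋ (◇⁻ r′) A∈) ⊩A

  provable-or-refutable : ∀ {A} (m : PurelyModal A) → A ∈ S
                        → (DKS4 [ fml A ] × S4⊢ ⟦ m ⟧) ⊎ Refutable ⟦ m ⟧
  provable-or-refutable m A∈S with derivable? (∅ ⊕ A∈S)
  ... | yes d =
    inj₁ ( Der⇒DKS4 N d (covers-singleton {f = fml} A∈S)
         , subst S4⊢_ (⌜⌝≡⟦⟧ m) (⊢-closed (⊢-by-contradiction (Der⇒⊢ N d (covers-singleton A∈S)))))
  ... | no d̸ =
    let 𝔴 , ⊆𝔴 = saturate d̸ in inj₂ (canonical , 𝔴 , truth m 𝔴 (index-∋ A∈S (⊆𝔴 (∈-⊕ A∈S))))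

mutual
  subformulas : Fml → List Fml
  subformulas A = A ∷ proper-subformulas A

  proper-subformulas : Fml → List Fml
  proper-subformulas (atom _) = []
  proper-subformulas (neg _)  = []
  proper-subformulas (A ∨' B) = subformulas A ++ subformulas B
  proper-subformulas (A ∧' B) = subformulas A ++ subformulas B
  proper-subformulas (□ A)    = subformulas A
  proper-subformulas (■ A)    = subformulas A
  proper-subformulas (◇ A)    = subformulas A
  proper-subformulas (◆ A)    = subformulas A

mutual
  subformulas-trans : ∀ A {B C} → B ∈ subformulas A → C ∈ subformulas B → C ∈ subformulas A
  subformulas-trans A (here refl) C∈ = C∈
  subformulas-trans A (there B∈)  C∈ = there (proper-subformulas-trans A B∈ C∈)

  proper-subformulas-trans : ∀ A {B C} → B ∈ proper-subformulas A → C ∈ subformulas B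
                           → C ∈ proper-subformulas A
  proper-subformulas-trans (A₁ ∨' A₂) = binary-trans A₁ A₂
  proper-subformulas-trans (A₁ ∧' A₂) = binary-trans A₁ A₂
  proper-subformulas-trans (□ A)      = subformulas-trans A
  proper-subformulas-trans (■ A)      = subformulas-trans A
  proper-subformulas-trans (◇ A)      = subformulas-trans A
  proper-subformulas-trans (◆ A)      = subformulas-trans A

  binary-trans : ∀ A₁ A₂ {B C} → B ∈ subformulas A₁ ++ subformulas A₂ → C ∈ subformulas B
               → C ∈ subformulas A₁ ++ subformulas A₂
  binary-trans A₁ A₂ B∈ C∈ with ∈-++⁻ (subformulas A₁) B∈
  ... | inj₁ B∈₁ = ∈-++⁺ˡ (subformulas-trans A₁ B∈₁ C∈)
  ... | inj₂ B∈₂ = ∈-++⁺ʳ (subformulas A₁) (subformulas-trans A₂ B∈₂ C∈)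

subformulas-closed : ∀ A → SubformulaClosed (subformulas A)
subformulas-closed A = record
  { ∨⁻ˡ = λ {_} {B} p → subformulas-trans A p (there (∈-++⁺ˡ {ys = subformulas B} (here refl)))
  ; ∨⁻ʳ = λ {B} p → subformulas-trans A p (there (∈-++⁺ʳ (subformulas B) (here refl)))
  ; ∧⁻ˡ = λ {_} {B} p → subformulas-trans A p (there (∈-++⁺ˡ {ys = subformulas B} (here refl)))
  ; ∧⁻ʳ = λ {B} p → subformulas-trans A p (there (∈-++⁺ʳ (subformulas B) (here refl)))
  ; □⁻  = λ p → subformulas-trans A p (there (here refl))
  ; ◇⁻  = λ p → subformulas-trans A p (there (here refl))
  }

refutable⇒¬S4 : ∀ {A} → Refutable A → ¬ S4⊢ A
refutable⇒¬S4 (𝓜 , w , w⊮A) d = w⊮A (Semantics.S4-sound 𝓜 d w)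

refutable⇒¬DKS4 : ∀ {A} (m : PurelyModal A) → Refutable ⟦ m ⟧ → ¬ DKS4 [ fml A ]
refutable⇒¬DKS4 m (𝓜 , w , w⊮A) d =
  Semantics.DKS4-sound 𝓜 d w ((λ ⊩A → w⊮A (subst (Semantics._⊩_ 𝓜 w) (⌜⌝≡⟦⟧ m) ⊩A)) , tt)

theorem5p8 : (A : Fml) → (m : PurelyModal A) → DKS4 [ fml A ] ⇔ (S4⊢ ⟦ m ⟧)
theorem5p8 A m
  with ProofSearch.provable-or-refutable (subformulas A) (subformulas-closed A) m (here refl)
... | inj₁ (d , h) = mk⇔ (λ _ → h) (λ _ → d)
... | inj₂ r       = mk⇔ (⊥-elim ∘ refutable⇒¬DKS4 m r) (⊥-elim ∘ refutable⇒¬S4 r)
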